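{- Let $a,b\in\{0,\ldots,n-1\}^k$ with $a\le b$, and let $v\in\{0,\ldots,n-1\}^k$ be a vertex such that $\mathcal{C}(v)\cap\ell(a,b)\neq\emptyset$. Then the componentwise maximum $z=\max\{\mathcal{C}(v)\cap\ell(a,b)\}$ is well-defined (i.e. $\mathcal{C}(v)\cap\ell(a,b)$ has a point that is componentwise $\ge$ all its other points), and either $v=b$ or $z$ lies on some forward face of $\mathcal{C}(v)$.
   Context: $\le$ is the componentwise order. For a vertex $v$, $\mathcal{C}(v)$ is the closed axis-aligned cube of side length $1$ centered at $v$ (including its boundary). For $i\in[k]$, the face of $\mathcal{C}(v)$ on which coordinate $i$ is maximal (equal to $v_i+1/2$) is called a forward face. For $u,w\in\mathbb{R}^k$, $\ell(u,w)=\{\lambda u+(1-\lambda)w:\lambda\in[0,1]\}$.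
   Formalization: Points of $\mathcal{C}(v)$ and $\ell(a,b)$ are taken in ℚ^k rather than $\mathbb{R}^k$, and the segment parameter λ ranges over the rationals in [0,1]. -}

module Defs where

open import Data.Nat using (ℕ)
open import Data.Fin using (Fin; toℕ)
open import Data.Rational using (ℚ; _+_; _-_; _*_; _≤_; ½; 0ℚ; 1ℚ)
import Data.Rational as ℚ
import Data.Integer
open import Data.Product using (Σ; ∃; _×_)
open import Relation.Binary.PropositionalEquality using (_≡_)

-- Points of ℚ^k (reals replaced by rationals).
Point : ℕ → Set
Point k = Fin k → ℚ

Vertex : ℕ → ℕ → Set
Vertex n k = Fin k → Fin n

⟦_⟧ : ∀ {n k} → Vertex n k → Point k
⟦ v ⟧ i = Data.Integer.+ (toℕ (v i)) ℚ./ 1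

_≤ₚ_ : ∀ {k} → Point k → Point k → Set
x ≤ₚ y = ∀ i → x i ≤ y i

_≤ᵥ_ : ∀ {n k} → Vertex n k → Vertex n k → Set
a ≤ᵥ b = ∀ i → toℕ (a i) Data.Nat.≤ toℕ (b i)
  where import Data.Nat

InCube : ∀ {n k} → Vertex n k → Point k → Set
InCube v x = ∀ i → (⟦ v ⟧ i - ½ ≤ x i) × (x i ≤ ⟦ v ⟧ i + ½)

InSeg : ∀ {k} → Point k → Point k → Point k → Set
InSeg u w x = Σ ℚ λ t → (0ℚ ≤ t) × (t ≤ 1ℚ) × (∀ i → x i ≡ t * u i + (1ℚ - t) * w i)

-- x lies on a forward face of 𝒞(v) (assuming x ∈ 𝒞(v)).
OnForwardFace : ∀ {n k} → Vertex n k → Point k → Set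
OnForwardFace v x = ∃ λ i → x i ≡ ⟦ v ⟧ i + ½

{-# OPTIONS --safe #-}
-- Along the segment x(t) = t a + (1 - t) b every coordinate decreases as t grows, since
-- a ≤ b.  Hence the lower faces of the cube cut out an initial interval of parameters,
-- each upper face v_i + ½ cuts out a final one [t_i, ∞), and the componentwise maximum of
-- the intersection is x(t₀) for the least feasible parameter t₀ = max (0, t_i …).  Either
-- t₀ = 0, so z = b lies in the cube of v and v = b by integrality, or t₀ = t_i for some
-- i, and then z_i = v_i + ½.
module Submission where

open import Defs
open import Data.Nat using (ℕ)
open import Data.Fin using (Fin)
open import Data.Product using (∃; _×_)
open import Data.Sum using (_⊎_)
open import Relation.Binary.PropositionalEquality using (_≡_)

import Data.Nat as ℕ
import Data.Nat.Properties as ℕ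
open import Data.Nat.Coprimality using (1-coprimeTo) renaming (sym to coprime-sym)
open import Data.Fin using (toℕ)
open import Data.Fin.Properties using (toℕ-injective)
import Data.Integer as ℤ
import Data.Integer.Properties as ℤ
open import Data.Rational
  using ( ℚ; mkℚ; toℚᵘ; *≤*; _/_; _+_; _-_; -_; _*_; 1/_; _÷_; _≤_; _<?_; ½; 0ℚ; 1ℚ
        ; Positive; NonZero; positive; nonNegative)
import Data.Rational.Properties as ℚ
import Data.Rational.Unnormalised as ℚᵘ
import Data.Rational.Unnormalised.Properties as ℚᵘ
open import Data.Rational.Solver using (module +-*-Solver)
open import Data.List.Base as List using ()
import Data.List.Relation.Unary.All.Properties as All
open import Relation.Binary.Bundles using (DecTotalOrder)
open import Data.List.Extrema (DecTotalOrder.totalOrder ℚ.≤-decTotalOrder)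
  using (max; ⊥≤max; xs≤max; max≤v⁺; argmax-all)
open import Data.Product using (_,_; proj₁; proj₂)
open import Data.Sum as Sum using (inj₁; inj₂)
open import Relation.Nullary using (yes; no)
open import Relation.Binary.PropositionalEquality
  using (refl; sym; trans; cong; subst; subst₂; module ≡-Reasoning)
open +-*-Solver using (solve; _:=_; _:+_; _:*_; _:-_; con)

fromℕ : ℕ → ℚ
fromℕ m = ℤ.+ m / 1

fromℕ≡mkℚ : ∀ m → fromℕ m ≡ mkℚ (ℤ.+ m) 0 (coprime-sym (1-coprimeTo m))
fromℕ≡mkℚ m = ℚ.normalize-coprime (coprime-sym (1-coprimeTo m))

fromℕ-mono-≤ : ∀ {m n} → m ℕ.≤ n → fromℕ m ≤ fromℕ n
fromℕ-mono-≤ {m} {n} m≤n = subst₂ _≤_ (sym (fromℕ≡mkℚ m)) (sym (fromℕ≡mkℚ n))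
  (*≤* (ℤ.*-monoʳ-≤-nonNeg (ℤ.+ 1) (ℤ.+≤+ m≤n)))

-- Clearing denominators turns the hypothesis into 2n ≤ 2m + 1.
fromℕ≤fromℕ+½⇒≤ : ∀ m n → fromℕ n ≤ fromℕ m + ½ → n ℕ.≤ m
fromℕ≤fromℕ+½⇒≤ m n n≤m+½ = ℕ.m<1+n⇒m≤n (ℕ.*-cancelʳ-< 2 n (ℕ.suc m) (ℕ.s≤s 2n≤2m+1))
  where
  unnormalised : ℚᵘ.mkℚᵘ (ℤ.+ n) 0 ℚᵘ.≤ ℚᵘ.mkℚᵘ (ℤ.+ m) 0 ℚᵘ.+ toℚᵘ ½
  unnormalised = subst₂ (λ p q → toℚᵘ p ℚᵘ.≤ toℚᵘ q ℚᵘ.+ toℚᵘ ½) (fromℕ≡mkℚ n) (fromℕ≡mkℚ m)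
    (ℚᵘ.≤-respʳ-≃ (ℚ.toℚᵘ-homo-+ (fromℕ m) ½) (ℚ.toℚᵘ-mono-≤ n≤m+½))
  2n≤2m+1 : n ℕ.* 2 ℕ.≤ ℕ.suc (m ℕ.* 2)
  2n≤2m+1 = ℤ.drop‿+≤+ (subst₂ ℤ._≤_ (sym (ℤ.pos-* n 2))
    (trans (ℤ.*-identityʳ _)
      (trans (cong (ℤ._+ ℤ.+ 1) (sym (ℤ.pos-* m 2))) (cong ℤ.+_ (ℕ.+-comm (m ℕ.* 2) 1))))
    (ℚᵘ.drop-*≤* unnormalised))

fromℕ-within-½⇒≡ : ∀ m n → fromℕ m - ½ ≤ fromℕ n → fromℕ n ≤ fromℕ m + ½ → n ≡ m
fromℕ-within-½⇒≡ m n m-½≤n n≤m+½ =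
  ℕ.≤-antisym (fromℕ≤fromℕ+½⇒≤ m n n≤m+½) (fromℕ≤fromℕ+½⇒≤ n m m≤n+½)
  where
  m≤n+½ : fromℕ m ≤ fromℕ n + ½
  m≤n+½ = subst (_≤ fromℕ n + ½) (solve 2 (λ x y → (x :- y) :+ y := x) refl (fromℕ m) ½)
    (ℚ.+-monoˡ-≤ ½ m-½≤n)

÷-*-cancel : ∀ c d .{{_ : NonZero d}} → (c ÷ d) * d ≡ c
÷-*-cancel c d = begin
  c * 1/ d * d    ≡⟨ ℚ.*-assoc c _ d ⟩
  c * (1/ d * d)  ≡⟨ cong (c *_) (ℚ.*-inverseˡ d) ⟩
  c * 1ℚ          ≡⟨ ℚ.*-identityʳ c ⟩
  c               ∎
  where open ≡-Reasoning

module _ (c d : ℚ) {t : ℚ} .{{_ : Positive d}} where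
  private instance
    d≢0 : NonZero d
    d≢0 = ℚ.pos⇒nonZero d

  ≤*⇒÷≤ : c ≤ t * d → c ÷ d ≤ t
  ≤*⇒÷≤ c≤td = ℚ.*-cancelʳ-≤-pos d (subst (_≤ t * d) (sym (÷-*-cancel c d)) c≤td)

  ÷≤⇒≤* : c ÷ d ≤ t → c ≤ t * d
  ÷≤⇒≤* c÷d≤t = subst (_≤ t * d) (÷-*-cancel c d)
    (ℚ.*-monoʳ-≤-nonNeg d {{nonNegative (ℚ.<⇒≤ (ℚ.positive⁻¹ d))}} c÷d≤t)

threshold : ℚ → ℚ → ℚ
threshold c d with 0ℚ <? d
... | yes 0<d = (c ÷ d) {{ℚ.pos⇒nonZero d {{positive 0<d}}}}
... | no  _   = 0ℚ

threshold-least : ∀ c d {t} → 0ℚ ≤ t → c ≤ t * d → threshold c d ≤ t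
threshold-least c d 0≤t c≤td with 0ℚ <? d
... | yes 0<d = ≤*⇒÷≤ c d {{positive 0<d}} c≤td
... | no  _   = 0≤t

-- For d = 0 the constraint c ≤ t * d does not depend on t, so one solution s suffices.
threshold-sound : ∀ c d {s t} → 0ℚ ≤ d → c ≤ s * d → threshold c d ≤ t → c ≤ t * d
threshold-sound c d {s} {t} 0≤d c≤sd θ≤t with 0ℚ <? d
... | yes 0<d = ÷≤⇒≤* c d {{positive 0<d}} θ≤t
... | no  0≮d = subst (λ e → c ≤ t * e) (sym d≡0) (begin
  c       ≤⟨ subst (λ e → c ≤ s * e) d≡0 c≤sd ⟩
  s * 0ℚ  ≡⟨ ℚ.*-zeroʳ s ⟩
  0ℚ      ≡⟨ ℚ.*-zeroʳ t ⟨
  t * 0ℚ  ∎)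
  where
  open ℚ.≤-Reasoning
  d≡0 : d ≡ 0ℚ
  d≡0 = ℚ.≤-antisym (ℚ.≮⇒≥ 0≮d) 0≤d

threshold-tight : ∀ c d → threshold c d ≡ 0ℚ ⊎ threshold c d * d ≡ c
threshold-tight c d with 0ℚ <? d
... | yes 0<d = inj₂ (÷-*-cancel c d {{ℚ.pos⇒nonZero d {{positive 0<d}}}})
... | no  _   = inj₁ refl

module LeastSolution {k : ℕ} (c d : Fin k → ℚ) where

  Solution : ℚ → Set
  Solution t = ∀ i → c i ≤ t * d i

  thresholds : List.List ℚ
  thresholds = List.tabulate λ i → threshold (c i) (d i)

  t₀ : ℚ
  t₀ = max 0ℚ thresholds

  0≤t₀ : 0ℚ ≤ t₀
  0≤t₀ = ⊥≤max 0ℚ thresholds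

  t₀-least : ∀ {t} → 0ℚ ≤ t → Solution t → t₀ ≤ t
  t₀-least 0≤t sol = max≤v⁺ {xs = thresholds} 0≤t
    (All.tabulate⁺ λ i → threshold-least (c i) (d i) 0≤t (sol i))

  t₀-solution : ∀ {s} → (∀ i → 0ℚ ≤ d i) → Solution s → Solution t₀
  t₀-solution {s} 0≤d sol i = threshold-sound (c i) (d i) {s} (0≤d i) (sol i)
    (All.tabulate⁻ (xs≤max 0ℚ thresholds) i)

  t₀-tight : t₀ ≡ 0ℚ ⊎ ∃ λ i → t₀ * d i ≡ c i
  t₀-tight = argmax-all (λ t → t) {P = Tight} (inj₁ refl) (All.tabulate⁺ threshold-Tight)
    where
    Tight : ℚ → Set
    Tight t = t ≡ 0ℚ ⊎ ∃ λ i → t * d i ≡ c i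
    threshold-Tight : ∀ i → Tight (threshold (c i) (d i))
    threshold-Tight i with threshold-tight (c i) (d i)
    ... | inj₁ θ≡0 = inj₁ θ≡0
    ... | inj₂ θd≡c = inj₂ (i , θd≡c)

p≤q⇒0≤q-p : ∀ {p q} → p ≤ q → 0ℚ ≤ q - p
p≤q⇒0≤q-p {p} {q} p≤q = subst (_≤ q - p) (ℚ.+-inverseʳ p) (ℚ.+-monoˡ-≤ (- p) p≤q)

p-q≤r⇒p-r≤q : ∀ p q r → p - q ≤ r → p - r ≤ q
p-q≤r⇒p-r≤q p q r p-q≤r = subst₂ _≤_
  (solve 3 (λ p q r → (p :- q) :+ (q :- r) := p :- r) refl p q r)
  (solve 2 (λ q r → r :+ (q :- r) := q) refl q r)
  (ℚ.+-monoˡ-≤ (q - r) p-q≤r)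

segmentPoint : ℚ → ℚ → ℚ → ℚ
segmentPoint t a b = t * a + (1ℚ - t) * b

segmentPoint≡ : ∀ t a b → segmentPoint t a b ≡ b - t * (b - a)
segmentPoint≡ = solve 3 (λ t a b → t :* a :+ (con 1ℚ :- t) :* b := b :- t :* (b :- a)) refl

segmentPoint-zero : ∀ a b → segmentPoint 0ℚ a b ≡ b
segmentPoint-zero = solve 2 (λ a b → con 0ℚ :* a :+ (con 1ℚ :- con 0ℚ) :* b := b) refl

segmentPoint-antitone : ∀ {a b s t} → a ≤ b → t ≤ s → segmentPoint s a b ≤ segmentPoint t a b
segmentPoint-antitone {a} {b} {s} {t} a≤b t≤s =
  subst₂ _≤_ (sym (segmentPoint≡ s a b)) (sym (segmentPoint≡ t a b)) (ℚ.+-monoʳ-≤ b 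
    (ℚ.neg-antimono-≤ (ℚ.*-monoʳ-≤-nonNeg (b - a) {{nonNegative (p≤q⇒0≤q-p a≤b)}} t≤s)))

segmentPoint≤⇒ : ∀ t a b u → segmentPoint t a b ≤ u → b - u ≤ t * (b - a)
segmentPoint≤⇒ t a b u x≤u =
  p-q≤r⇒p-r≤q b (t * (b - a)) u (subst (_≤ u) (segmentPoint≡ t a b) x≤u)

≤⇒segmentPoint≤ : ∀ t a b u → b - u ≤ t * (b - a) → segmentPoint t a b ≤ u
≤⇒segmentPoint≤ t a b u b-u≤ =
  subst (_≤ u) (sym (segmentPoint≡ t a b)) (p-q≤r⇒p-r≤q b u (t * (b - a)) b-u≤)

segmentPoint-hits : ∀ t a b u → t * (b - a) ≡ b - u → segmentPoint t a b ≡ u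
segmentPoint-hits t a b u eq = begin
  segmentPoint t a b  ≡⟨ segmentPoint≡ t a b ⟩
  b - t * (b - a)     ≡⟨ cong (λ w → b - w) eq ⟩
  b - (b - u)         ≡⟨ solve 2 (λ b u → b :- (b :- u) := u) refl b u ⟩
  u                   ∎
  where open ≡-Reasoning

InCubeAt : ∀ {k} → Point k → Point k → Set
InCubeAt c x = ∀ i → (c i - ½ ≤ x i) × (x i ≤ c i + ½)

segment∩cube-max : ∀ {k} {A B V : Point k} → A ≤ₚ B →
  (∃ λ x → InCubeAt V x × InSeg A B x) →
  ∃ λ z → (InCubeAt V z × InSeg A B z)
    × (∀ x → InCubeAt V x → InSeg A B x → x ≤ₚ z)
    × ((∀ i → z i ≡ B i) ⊎ ∃ λ i → z i ≡ V i + ½)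
segment∩cube-max {k} {A} {B} {V} A≤B (x₀ , x₀∈C , s , 0≤s , s≤1 , x₀≡) =
  z , (z∈C , z∈ℓ) , z-max , z≡B⊎forward
  where
  open LeastSolution (λ i → B i - (V i + ½)) (λ i → B i - A i)

  below-upper-faces⇒solution : ∀ {x t} → InCubeAt V x →
    (∀ i → x i ≡ segmentPoint t (A i) (B i)) → Solution t
  below-upper-faces⇒solution {t = t} x∈C x≡ i =
    segmentPoint≤⇒ t (A i) (B i) (V i + ½) (subst (_≤ V i + ½) (x≡ i) (proj₂ (x∈C i)))

  t₀≤s : t₀ ≤ s
  t₀≤s = t₀-least 0≤s (below-upper-faces⇒solution {t = s} x₀∈C x₀≡)

  z : Point k
  z i = segmentPoint t₀ (A i) (B i)

  z∈C : InCubeAt V z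
  z∈C i =
    ℚ.≤-trans (subst (V i - ½ ≤_) (x₀≡ i) (proj₁ (x₀∈C i))) (segmentPoint-antitone (A≤B i) t₀≤s) ,
    ≤⇒segmentPoint≤ t₀ (A i) (B i) (V i + ½)
      (t₀-solution {s} (λ j → p≤q⇒0≤q-p (A≤B j)) (below-upper-faces⇒solution {t = s} x₀∈C x₀≡) i)

  z∈ℓ : InSeg A B z
  z∈ℓ = t₀ , 0≤t₀ , ℚ.≤-trans t₀≤s s≤1 , λ i → refl

  z-max : ∀ x → InCubeAt V x → InSeg A B x → x ≤ₚ z
  z-max x x∈C (t , 0≤t , _ , x≡) i = subst (_≤ z i) (sym (x≡ i))
    (segmentPoint-antitone (A≤B i) (t₀-least 0≤t (below-upper-faces⇒solution {t = t} x∈C x≡)))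

  z≡B⊎forward : (∀ i → z i ≡ B i) ⊎ ∃ λ i → z i ≡ V i + ½
  z≡B⊎forward with t₀-tight
  ... | inj₁ t₀≡0 =
    inj₁ λ i → trans (cong (λ t → segmentPoint t (A i) (B i)) t₀≡0) (segmentPoint-zero (A i) (B i))
  ... | inj₂ (i , tight) = inj₂ (i , segmentPoint-hits t₀ (A i) (B i) (V i + ½) tight)

⟦⟧-mono : ∀ {n k} {a b : Vertex n k} → a ≤ᵥ b → ⟦ a ⟧ ≤ₚ ⟦ b ⟧
⟦⟧-mono a≤b i = fromℕ-mono-≤ (a≤b i)

cube∋vertex⇒≡ : ∀ {n k} {v b : Vertex n k} {z : Point k} →
  InCube v z → (∀ i → z i ≡ ⟦ b ⟧ i) → ∀ i → v i ≡ b i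
cube∋vertex⇒≡ {v = v} {b} z∈C z≡b i =
  toℕ-injective (sym (fromℕ-within-½⇒≡ (toℕ (v i)) (toℕ (b i))
  (subst (⟦ v ⟧ i - ½ ≤_) (z≡b i) (proj₁ (z∈C i)))
  (subst (_≤ ⟦ v ⟧ i + ½) (z≡b i) (proj₂ (z∈C i)))))

lemma6 : ∀ {n k} (a b v : Vertex n k) → a ≤ᵥ b →
    (∃ λ x → InCube v x × InSeg ⟦ a ⟧ ⟦ b ⟧ x) →
    ∃ λ z → (InCube v z × InSeg ⟦ a ⟧ ⟦ b ⟧ z)
      × (∀ x → InCube v x → InSeg ⟦ a ⟧ ⟦ b ⟧ x → x ≤ₚ z)
      × ((∀ i → v i ≡ b i) ⊎ OnForwardFace v z)
lemma6 a b v a≤b nonempty =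
  let z , z∈C∩ℓ , z-max , z≡b⊎forward = segment∩cube-max {V = ⟦ v ⟧} (⟦⟧-mono a≤b) nonempty
  in  z , z∈C∩ℓ , z-max , Sum.map₁ (cube∋vertex⇒≡ (proj₁ z∈C∩ℓ)) z≡b⊎forward
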